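{- Let $c$ be a nonnegative integer, $r$ a positive integer, $G$ a multigraph, and $\mathcal{C}$ a cluster partition of $G$ of capacity at most $r$ such that $\delta(G/\mathcal{C})\geq 8c$. Define $w:V(G)\to\mathbb{R}_{\geq 0}$ by $w(v)=|\mathsf{ext}(C)|/|C|$ for $v\in C\in\mathcal{C}$. Then for every $c$-bond cover $X$ of $G$, \[\frac{1}{2r}\,|E(G/\mathcal{C})|\;\leq\;\sum_{v\in X}w(v)\;\leq\;2\,|E(G/\mathcal{C})|.\]
   Context: Graphs are finite multigraphs without loops; edge counts are with multiplicity. $\delta(H)$ is the minimum edge-degree (number of incident edges) of a vertex of $H$. $\theta_c$ is the multigraph with two vertices joined by $c$ parallel edges; $X\subseteq V(G)$ is a $c$-bond cover of $G$ if $G-X$ is $\theta_c$-minor free. A cluster partition of $G$ is a partition of $V(G)$ into nonempty sets each inducing a connected subgraph; its capacity is the maximum size of a part. $G/\mathcal{C}$ is the multigraph obtained by contracting each part to a single vertex, summing multiplicities of parallel edges and deleting loops. For $C\in\mathcal{C}$, $\mathsf{ext}(C)$ is the set of edges with exactly one endpoint in $C$. -}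

module Defs where

open import Data.Nat using (ℕ; zero; suc; _≤_; _*_)
open import Data.Fin using (Fin; _≟_) renaming (zero to f0; suc to fs)
open import Data.Fin.Subset using (Subset; _∈_; _∉_; ∁; ∣_∣)
open import Data.Fin.Subset.Properties using (_∈?_)
open import Data.Product using (Σ; ∃; _×_; _,_; proj₁; proj₂)
open import Data.Sum using (_⊎_)
open import Data.Bool using (Bool; true; false; if_then_else_; _xor_)
open import Data.List using (List; []; _∷_; length; filter; map; lookup; replicate; foldr; allFin)
open import Data.List.Relation.Unary.All using (All)
open import Data.List.Relation.Unary.All.Properties using (all-filter; map⁺; replicate⁺)
import Data.List.Membership.Propositional as L
open import Data.Vec using (tabulate)
open import Data.Integer using (+_)
open import Data.Rational using (ℚ; 0ℚ; _/_; _+_)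
open import Function.Definitions using (Injective)
open import Relation.Binary.PropositionalEquality using (_≡_; _≢_)
open import Relation.Nullary using (¬_; Dec; does)
open import Relation.Nullary.Decidable using (¬?; ⌊_⌋; _⊎-dec_)

-- Finite loopless multigraphs: vertex set Fin V, edges a list of
-- ordered pairs of distinct vertices (list entries = edges, so
-- parallel edges are repeated entries; edge counts are with multiplicity).

record Multigraph : Set where
  field
    V        : ℕ
    E        : List (Fin V × Fin V)
    loopless : All (λ e → proj₁ e ≢ proj₂ e) E
open Multigraph public

∥E∥ : Multigraph → ℕ
∥E∥ G = length (E G)

deg : (G : Multigraph) → Fin (V G) → ℕ
deg G v = length (filter (λ e → (proj₁ e ≟ v) ⊎-dec (proj₂ e ≟ v)) (E G))

minDeg≥ : Multigraph → ℕ → Set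
minDeg≥ G t = ∀ v → t ≤ deg G v

Adj : (G : Multigraph) → Fin (V G) → Fin (V G) → Set
Adj G a b = ((a , b) L.∈ E G) ⊎ ((b , a) L.∈ E G)

data WalkIn (G : Multigraph) (B : Subset (V G)) : Fin (V G) → Fin (V G) → Set where
  here : ∀ {a} → a ∈ B → WalkIn G B a a
  step : ∀ {a x b} → a ∈ B → Adj G a x → WalkIn G B x b → WalkIn G B a b

ConnectedSet : (G : Multigraph) → Subset (V G) → Set
ConnectedSet G B = ∀ a b → a ∈ B → b ∈ B → WalkIn G B a b

record MinorModelIn (G : Multigraph) (S : Subset (V G)) (H : Multigraph) : Set where
  field
    branch    : Fin (V H) → Subset (V G)
    inS       : ∀ u x → x ∈ branch u → x ∈ S
    nonempty  : ∀ u → ∃ λ x → x ∈ branch u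
    disjoint  : ∀ u u' x → x ∈ branch u → x ∈ branch u' → u ≡ u'
    connected : ∀ u → ConnectedSet G (branch u)
    edgeMap   : Fin (length (E H)) → Fin (length (E G))
    edgeInj   : Injective _≡_ _≡_ edgeMap
    edgeOk    : ∀ j →
      let u = proj₁ (lookup (E H) j) ; u' = proj₂ (lookup (E H) j)
          a = proj₁ (lookup (E G) (edgeMap j)) ; b = proj₂ (lookup (E G) (edgeMap j))
      in (a ∈ branch u × b ∈ branch u') ⊎ (a ∈ branch u' × b ∈ branch u)

HasMinorIn : (G : Multigraph) → Subset (V G) → Multigraph → Set
HasMinorIn G S H = MinorModelIn G S H

θ : ℕ → Multigraph
θ c = record { V = 2 ; E = replicate c (f0 , fs f0) ; loopless = replicate⁺ c (λ ()) }

BondCover : ℕ → (G : Multigraph) → Subset (V G) → Set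
BondCover c G X = ¬ HasMinorIn G (∁ X) (θ c)

record ClusterPartition (G : Multigraph) : Set where
  field
    k         : ℕ
    cl        : Fin (V G) → Fin k
  part : Fin k → Subset (V G)
  part i = tabulate (λ v → ⌊ cl v ≟ i ⌋)
  field
    nonempty  : ∀ i → ∃ λ v → cl v ≡ i
    connected : ∀ i → ConnectedSet G (part i)
open ClusterPartition public

CapacityAtMost : {G : Multigraph} → ClusterPartition G → ℕ → Set
CapacityAtMost 𝒞 r = ∀ i → ∣ part 𝒞 i ∣ ≤ r

private
  interPart? : {G : Multigraph} (𝒞 : ClusterPartition G) (e : Fin (V G) × Fin (V G)) →
               Dec (cl 𝒞 (proj₁ e) ≢ cl 𝒞 (proj₂ e))
  interPart? 𝒞 e = ¬? (cl 𝒞 (proj₁ e) ≟ cl 𝒞 (proj₂ e))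

_/ᶜ_ : (G : Multigraph) → ClusterPartition G → Multigraph
G /ᶜ 𝒞 = record
  { V = k 𝒞
  ; E = map (λ e → cl 𝒞 (proj₁ e) , cl 𝒞 (proj₂ e)) (filter (interPart? 𝒞) (E G))
  ; loopless = map⁺ (all-filter (interPart? 𝒞) (E G))
  }

ext : (G : Multigraph) → Subset (V G) → List (Fin (V G) × Fin (V G))
ext G C = filter (λ e → exactlyOne? e) (E G)
  where
  exactlyOne? : (e : Fin (V G) × Fin (V G)) → Dec ((does (proj₁ e ∈? C) xor does (proj₂ e ∈? C)) ≡ true)
  exactlyOne? e = Data.Bool._≟_ (does (proj₁ e ∈? C) xor does (proj₂ e ∈? C)) true
    where import Data.Bool

-- Rational helpers.  frac a b = a / b for b ≥ 1 (and 0 for b = 0, a case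
-- that never arises below).

frac : ℕ → ℕ → ℚ
frac a zero    = 0ℚ
frac a (suc b) = (+ a) / suc b

weight : (G : Multigraph) → ClusterPartition G → Fin (V G) → ℚ
weight G 𝒞 v = frac (length (ext G (part 𝒞 (cl 𝒞 v)))) ∣ part 𝒞 (cl 𝒞 v) ∣

sumOver : {n : ℕ} → Subset n → (Fin n → ℚ) → ℚ
sumOver X f = foldr (λ v acc → (if does (v ∈? X) then f v else 0ℚ) + acc) 0ℚ (allFin _)

-- Let A be the set of clusters meeting X and B the others; write deg(A) for the degree sum of A in
-- G/𝒞 and e(B) for the number of edges of G/𝒞 inside B. The clusters of B lie in G − X, which has no
-- θ_c minor, so e(B) ≤ c|B|: if the classes of a crossing edge were joined by c edges they would be
-- the branch sets of a θ_c model, so merging them loses fewer than c crossing edges and one class.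
-- Since δ(G/𝒞) ≥ 8c, summing degrees over B gives 8c|B| ≤ 2e(B) + deg(A), hence e(B) ≤ deg(A) and
-- |E(G/𝒞)| ≤ deg(A) + e(B) ≤ 2 deg(A). Grouped by cluster, ∑_{v∈X} w(v) = ∑_C |X ∩ C| |ext C| / |C|,
-- which lies between deg(A)/r and ∑_C |ext C| = 2|E(G/𝒞)|.

module Submission where

open import Defs
open import Data.Nat using (ℕ; _≤_; _*_)
open import Data.Fin.Subset using (Subset)
open import Data.Product using (_×_)
open import Data.Rational using (ℚ) renaming (_≤_ to _≤ℚ_)

open import Algebra.Bundles using (Semiring; Ring)
import Algebra.Properties.Semiring.Sum as SemiringSum
open import Data.Bool using (Bool; true; false; not; _∧_; _∨_; _xor_; if_then_else_)
import Data.Bool.Properties as Bool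
open import Data.Fin using (Fin; zero; suc; _≟_)
import Data.Fin.Properties as Fin
open import Data.Fin.Subset using (_∈_; _∉_; _⊆_; _∩_; ∁; ∣_∣; Nonempty; ⁅_⁆)
open import Data.Fin.Subset.Properties
  using (_∈?_; nonempty?; x∈p∩q⁺; x∈p∩q⁻; x∉p⇒x∈∁p; x∈⁅y⁆⇒x≡y; ∣⁅x⁆∣≡1; p⊆q⇒∣p∣≤∣q∣; ∣p∩q∣≤∣q∣)
import Data.Integer as ℤ
import Data.Integer.Properties as ℤ
open import Data.Integer.Solver using (module +-*-Solver)
open import Data.List using (List; []; _∷_; length; filter; map; lookup)
import Data.List
open import Data.List.Membership.Propositional using () renaming (_∈_ to _∈ˡ_)
open import Data.List.Membership.Propositional.Properties using (∈-lookup)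
open import Data.List.Properties using (length-replicate)
import Data.List.Relation.Unary.All as All
open import Data.List.Relation.Unary.All.Properties using (replicate⁺)
open import Data.Nat using (zero; suc; _+_; _<_; _≰_; z≤n; s≤s)
import Data.Nat.Properties as ℕ
import Data.Nat.Solver
open import Data.Product using (Σ; _,_; proj₁; proj₂)
open import Data.Rational using (0ℚ; 1ℚ; toℚᵘ) renaming (_+_ to _+ℚ_; _*_ to _*ℚ_)
import Data.Rational.Properties as ℚₚ
open import Data.Rational.Unnormalised as ℚᵘ using (mkℚᵘ; *≡*; *≤*) renaming (_≃_ to _≃ᵘ_)
import Data.Rational.Unnormalised.Properties as ℚᵘ
open import Data.Sum using (_⊎_; inj₁; inj₂)
open import Data.Vec using ([]; _∷_; tabulate)
import Data.Vec.Properties as Vec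
open import Function using (_∘_; id; Injective)
open import Level using (0ℓ)
open import Relation.Binary.PropositionalEquality
  using (_≡_; _≢_; refl; sym; trans; cong; cong₂; subst; subst₂; module ≡-Reasoning)
open import Relation.Nullary using (Dec; yes; no; does; ¬_; contradiction)
open import Relation.Nullary.Decidable using (⌊_⌋; ¬?; _×-dec_; _⊎-dec_)
open import Relation.Unary using (Pred; Decidable)

-- Indicators and finite sums

⟦_⟧ : Bool → ℕ
⟦ b ⟧ = if b then 1 else 0

𝟙 : ∀ {P : Set} → Dec P → ℕ
𝟙 P? = ⟦ does P? ⟧

⟦∧⟧ : ∀ a b → ⟦ a ∧ b ⟧ ≡ ⟦ a ⟧ * ⟦ b ⟧
⟦∧⟧ false b = refl
⟦∧⟧ true  b = sym (ℕ.+-identityʳ ⟦ b ⟧)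

does-cong : ∀ {P Q : Set} → (P → Q) → (Q → P) → (P? : Dec P) (Q? : Dec Q) → does P? ≡ does Q?
does-cong P→Q Q→P (yes p) (yes q) = refl
does-cong P→Q Q→P (no ¬p) (no ¬q) = refl
does-cong P→Q Q→P (yes p) (no ¬q) = contradiction (P→Q p) ¬q
does-cong P→Q Q→P (no ¬p) (yes q) = contradiction (Q→P q) ¬p

does-≟-true : ∀ b → does (b Bool.≟ true) ≡ b
does-≟-true true  = refl
does-≟-true false = refl

𝟙-mono : ∀ {P Q : Set} → (P → Q) → (P? : Dec P) (Q? : Dec Q) → 𝟙 P? ≤ 𝟙 Q?
𝟙-mono P→Q (no _)  Q?       = z≤n
𝟙-mono P→Q (yes p) (yes _)  = ℕ.≤-refl
𝟙-mono P→Q (yes p) (no ¬q)  = contradiction (P→Q p) ¬q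

𝟙-cong : ∀ {P Q : Set} → (P → Q) → (Q → P) → (P? : Dec P) (Q? : Dec Q) → 𝟙 P? ≡ 𝟙 Q?
𝟙-cong P→Q Q→P P? Q? = cong ⟦_⟧ (does-cong P→Q Q→P P? Q?)

𝟙-≤-+ : ∀ {P Q R : Set} → (P → Q ⊎ R) → (P? : Dec P) (Q? : Dec Q) (R? : Dec R) → 𝟙 P? ≤ 𝟙 Q? + 𝟙 R?
𝟙-≤-+ split (no _)  Q? R? = z≤n
𝟙-≤-+ split (yes p) Q? R? with split p
... | inj₁ q = ℕ.≤-trans (𝟙-mono (λ _ → q) (yes p) Q?) (ℕ.m≤m+n _ _)
... | inj₂ r = ℕ.≤-trans (𝟙-mono (λ _ → r) (yes p) R?) (ℕ.m≤n+m _ _)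

𝟙-< : ∀ {P Q : Set} → ¬ P → Q → (P? : Dec P) (Q? : Dec Q) → 𝟙 P? < 𝟙 Q?
𝟙-< ¬p q (yes p) Q?      = contradiction p ¬p
𝟙-< ¬p q (no _)  (yes _) = s≤s z≤n
𝟙-< ¬p q (no _)  (no ¬q) = contradiction q ¬q

xor-≟ : ∀ {n} (x y i : Fin n) → does (x ≟ i) xor does (y ≟ i) ≡ not (does (x ≟ y)) ∧ (does (x ≟ i) ∨ does (y ≟ i))
xor-≟ x y i with x ≟ y
... | yes refl = Bool.xor-same (does (x ≟ i))
... | no x≢y with x ≟ i | y ≟ i
...   | yes refl | yes refl = contradiction refl x≢y
...   | yes _    | no _     = refl
...   | no _     | yes _    = refl
...   | no _     | no _     = refl

module Kronecker {c ℓ} (R : Semiring c ℓ) where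
  open Semiring R using (Carrier; _≈_; 0#; 1#; +-cong; +-congˡ; +-identityˡ; +-identityʳ;
    *-congˡ; *-assoc; *-identityˡ; zeroˡ)
    renaming (_+_ to _+ᴿ_; _*_ to _*ᴿ_; sym to ≈-sym)
  open SemiringSum R
  open import Relation.Binary.Reasoning.Setoid (Semiring.setoid R)

  δ : ∀ {n} → Fin n → Fin n → Carrier
  δ u i = if does (u ≟ i) then 1# else 0#

  ∑-δ : ∀ {n} (u : Fin n) (f : Fin n → Carrier) → ∑[ i < n ] (δ u i *ᴿ f i) ≈ f u
  ∑-δ {suc n} zero f = begin
    1# *ᴿ f zero +ᴿ ∑[ i < n ] (0# *ᴿ f (suc i))  ≈⟨ +-cong (*-identityˡ _) (sum-cong-≋ {n} (λ i → zeroˡ (f (suc i)))) ⟩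
    f zero +ᴿ ∑[ i < n ] 0#                      ≈⟨ +-congˡ (sum-replicate-zero n) ⟩
    f zero +ᴿ 0#                                 ≈⟨ +-identityʳ _ ⟩
    f zero                                      ∎
  ∑-δ {suc n} (suc u) f = begin
    0# *ᴿ f zero +ᴿ ∑[ i < n ] (δ u i *ᴿ f (suc i))  ≈⟨ +-cong (zeroˡ _) (∑-δ u (f ∘ suc)) ⟩
    0# +ᴿ f (suc u)                                ≈⟨ +-identityˡ _ ⟩
    f (suc u)                                     ∎

  ∑-fibres : ∀ {n k} (φ : Fin n → Fin k) (a : Fin n → Carrier) (g : Fin k → Carrier) →
    ∑[ v < n ] (a v *ᴿ g (φ v)) ≈ ∑[ i < k ] (∑[ v < n ] (a v *ᴿ δ (φ v) i) *ᴿ g i)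
  ∑-fibres {n} {k} φ a g = begin
    ∑[ v < n ] (a v *ᴿ g (φ v))                        ≈⟨ sum-cong-≋ {n} (λ v → *-congˡ (≈-sym (∑-δ (φ v) g))) ⟩
    ∑[ v < n ] (a v *ᴿ ∑[ i < k ] (δ (φ v) i *ᴿ g i))   ≈⟨ sum-cong-≋ {n} (λ v → *-distribˡ-sum {k} (a v) _) ⟩
    ∑[ v < n ] ∑[ i < k ] (a v *ᴿ (δ (φ v) i *ᴿ g i))   ≈⟨ sum-cong-≋ {n} (λ v → sum-cong-≋ {k} (λ i → ≈-sym (*-assoc _ _ _))) ⟩
    ∑[ v < n ] ∑[ i < k ] (a v *ᴿ δ (φ v) i *ᴿ g i)     ≈⟨ ∑-comm {n} {k} _ ⟩
    ∑[ i < k ] ∑[ v < n ] (a v *ᴿ δ (φ v) i *ᴿ g i)     ≈⟨ sum-cong-≋ {k} (λ i → ≈-sym (*-distribʳ-sum {n} (g i) _)) ⟩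
    ∑[ i < k ] (∑[ v < n ] (a v *ᴿ δ (φ v) i) *ᴿ g i)   ∎

module ∑ℕ = SemiringSum ℕ.+-*-semiring
open ∑ℕ using (sum-syntax; sum-cong-≗; ∑-distrib-+; ∑-comm; *-distribˡ-sum; *-distribʳ-sum)
open Kronecker ℕ.+-*-semiring using (δ; ∑-δ)

∑-mono-≤ : ∀ {n} {f g : Fin n → ℕ} → (∀ i → f i ≤ g i) → ∑[ i < n ] f i ≤ ∑[ i < n ] g i
∑-mono-≤ {zero}  f≤g = z≤n
∑-mono-≤ {suc n} f≤g = ℕ.+-mono-≤ (f≤g zero) (∑-mono-≤ (f≤g ∘ suc))

∑-mono-< : ∀ {n} {f g : Fin n → ℕ} → (∀ i → f i ≤ g i) → ∀ j → f j < g j →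
  ∑[ i < n ] f i < ∑[ i < n ] g i
∑-mono-< f≤g zero    fj<gj = ℕ.+-mono-<-≤ fj<gj (∑-mono-≤ (f≤g ∘ suc))
∑-mono-< f≤g (suc j) fj<gj = ℕ.+-mono-≤-< (f≤g zero) (∑-mono-< (f≤g ∘ suc) j fj<gj)

∑ᴸ : {A : Set} → List A → (A → ℕ) → ℕ
∑ᴸ xs h = ∑[ j < length xs ] h (lookup xs j)

module _ {A : Set} where

  ∑ᴸ-map : ∀ {B : Set} (f : A → B) (xs : List A) (h : B → ℕ) → ∑ᴸ (map f xs) h ≡ ∑ᴸ xs (h ∘ f)
  ∑ᴸ-map f []       h = refl
  ∑ᴸ-map f (x ∷ xs) h = cong (h (f x) +_) (∑ᴸ-map f xs h)

  ∑ᴸ-filter : ∀ {P : Pred A 0ℓ} (P? : Decidable P) (xs : List A) (h : A → ℕ) →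
    ∑ᴸ (filter P? xs) h ≡ ∑ᴸ xs (λ x → 𝟙 (P? x) * h x)
  ∑ᴸ-filter P? []       h = refl
  ∑ᴸ-filter P? (x ∷ xs) h with does (P? x)
  ... | false = ∑ᴸ-filter P? xs h
  ... | true  = cong₂ _+_ (sym (ℕ.+-identityʳ (h x))) (∑ᴸ-filter P? xs h)

  length≡∑ᴸ1 : (xs : List A) → length xs ≡ ∑ᴸ xs (λ _ → 1)
  length≡∑ᴸ1 []       = refl
  length≡∑ᴸ1 (x ∷ xs) = cong suc (length≡∑ᴸ1 xs)

  length-filter : ∀ {P : Pred A 0ℓ} (P? : Decidable P) (xs : List A) →
    length (filter P? xs) ≡ ∑ᴸ xs (𝟙 ∘ P?)
  length-filter P? xs = begin
    length (filter P? xs)                 ≡⟨ length≡∑ᴸ1 (filter P? xs) ⟩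
    ∑ᴸ (filter P? xs) (λ _ → 1)           ≡⟨ ∑ᴸ-filter P? xs (λ _ → 1) ⟩
    ∑ᴸ xs (λ x → 𝟙 (P? x) * 1)            ≡⟨ sum-cong-≗ (λ j → ℕ.*-identityʳ (𝟙 (P? (lookup xs j)))) ⟩
    ∑ᴸ xs (𝟙 ∘ P?)                         ∎
    where open ≡-Reasoning

  ∑ᴸ-choice : ∀ {P : Pred A 0ℓ} (P? : Decidable P) (xs : List A) {c} → c ≤ ∑ᴸ xs (𝟙 ∘ P?) →
    Σ (Fin c → Fin (length xs)) λ f → Injective _≡_ _≡_ f × (∀ i → P (lookup xs (f i)))
  ∑ᴸ-choice P? xs {zero} _ = (λ ()) , (λ { {()} }) , λ ()
  ∑ᴸ-choice {P} P? (x ∷ xs) {suc c} c≤ with P? x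
  ... | no _ with ∑ᴸ-choice P? xs c≤
  ...   | f , f-inj , Pf = suc ∘ f , f-inj ∘ Fin.suc-injective , Pf
  ∑ᴸ-choice {P} P? (x ∷ xs) {suc c} (s≤s c≤) | yes Px with ∑ᴸ-choice P? xs c≤
  ... | f , f-inj , Pf = g , g-inj , Pg
    where
    g : Fin (suc c) → Fin (length (x ∷ xs))
    g zero    = zero
    g (suc i) = suc (f i)
    g-inj : Injective _≡_ _≡_ g
    g-inj {zero}  {zero}  _  = refl
    g-inj {suc i} {suc j} eq = cong suc (f-inj (Fin.suc-injective eq))
    Pg : ∀ i → P (lookup (x ∷ xs) (g i))
    Pg zero    = Px
    Pg (suc i) = Pf i

-- Fractions

frac-≃ : ∀ a d → toℚᵘ (frac a (suc d)) ≃ᵘ mkℚᵘ (ℤ.+ a) d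
frac-≃ a d = ℚₚ.toℚᵘ-fromℚᵘ (mkℚᵘ (ℤ.+ a) d)

frac-0 : ∀ d → frac 0 (suc d) ≡ 0ℚ
frac-0 d = ℚₚ.toℚᵘ-injective (ℚᵘ.≃-trans (frac-≃ 0 d) (*≡* refl))

frac-+ : ∀ a b d → frac a (suc d) +ℚ frac b (suc d) ≡ frac (a + b) (suc d)
frac-+ a b d = ℚₚ.toℚᵘ-injective (begin-equality
  toℚᵘ (frac a (suc d) +ℚ frac b (suc d))           ≃⟨ ℚₚ.toℚᵘ-homo-+ (frac a (suc d)) (frac b (suc d)) ⟩
  toℚᵘ (frac a (suc d)) ℚᵘ.+ toℚᵘ (frac b (suc d))  ≃⟨ ℚᵘ.+-cong (frac-≃ a d) (frac-≃ b d) ⟩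
  mkℚᵘ (ℤ.+ a) d ℚᵘ.+ mkℚᵘ (ℤ.+ b) d                ≃⟨ *≡* (cross (ℤ.+ a) (ℤ.+ b) (ℤ.+ suc d)) ⟩
  mkℚᵘ (ℤ.+ (a + b)) d                              ≃⟨ ℚᵘ.≃-sym (frac-≃ (a + b) d) ⟩
  toℚᵘ (frac (a + b) (suc d))                       ∎)
  where
  open ℚᵘ.≤-Reasoning
  open +-*-Solver
  cross : ∀ x y z → ℤ._*_ (ℤ._+_ (ℤ._*_ x z) (ℤ._*_ y z)) z ≡ ℤ._*_ (ℤ._+_ x y) (ℤ._*_ z z)
  cross = solve 3 (λ x y z → (x :* z :+ y :* z) :* z := (x :+ y) :* (z :* z)) refl

frac-* : ∀ a b d → frac a 1 *ℚ frac b (suc d) ≡ frac (a * b) (suc d)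
frac-* a b d = ℚₚ.toℚᵘ-injective (begin-equality
  toℚᵘ (frac a 1 *ℚ frac b (suc d))           ≃⟨ ℚₚ.toℚᵘ-homo-* (frac a 1) (frac b (suc d)) ⟩
  toℚᵘ (frac a 1) ℚᵘ.* toℚᵘ (frac b (suc d))  ≃⟨ ℚᵘ.*-cong (frac-≃ a 0) (frac-≃ b d) ⟩
  mkℚᵘ (ℤ.+ a) 0 ℚᵘ.* mkℚᵘ (ℤ.+ b) d          ≃⟨ *≡* (cong₂ ℤ._*_ (sym (ℤ.pos-* a b)) (cong ℤ.+_ (sym (ℕ.*-identityˡ (suc d))))) ⟩
  mkℚᵘ (ℤ.+ (a * b)) d                        ≃⟨ ℚᵘ.≃-sym (frac-≃ (a * b) d) ⟩
  toℚᵘ (frac (a * b) (suc d))                 ∎)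
  where open ℚᵘ.≤-Reasoning

frac-≤ : ∀ a b d e → a * suc e ≤ b * suc d → frac a (suc d) ≤ℚ frac b (suc e)
frac-≤ a b d e cross = ℚₚ.toℚᵘ-cancel-≤ (begin
  toℚᵘ (frac a (suc d))  ≃⟨ frac-≃ a d ⟩
  mkℚᵘ (ℤ.+ a) d         ≤⟨ *≤* (subst₂ ℤ._≤_ (ℤ.pos-* a (suc e)) (ℤ.pos-* b (suc d)) (ℤ.+≤+ cross)) ⟩
  mkℚᵘ (ℤ.+ b) e         ≃⟨ ℚᵘ.≃-sym (frac-≃ b e) ⟩
  toℚᵘ (frac b (suc e))  ∎)
  where open ℚᵘ.≤-Reasoning

ℚ-semiring : Semiring 0ℓ 0ℓ
ℚ-semiring = Ring.semiring ℚₚ.+-*-ring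

module ∑ℚ = SemiringSum ℚ-semiring
module δℚ = Kronecker ℚ-semiring

infixl 10 ∑ℚ-syntax
∑ℚ-syntax : ∀ n → (Fin n → ℚ) → ℚ
∑ℚ-syntax _ = ∑ℚ.sum
syntax ∑ℚ-syntax n (λ i → x) = ∑ℚ[ i < n ] x

∑ℚ-mono-≤ : ∀ {n} {f g : Fin n → ℚ} → (∀ i → f i ≤ℚ g i) → ∑ℚ[ i < n ] f i ≤ℚ ∑ℚ[ i < n ] g i
∑ℚ-mono-≤ {zero}  f≤g = ℚₚ.≤-refl
∑ℚ-mono-≤ {suc n} f≤g = ℚₚ.+-mono-≤ (f≤g zero) (∑ℚ-mono-≤ (f≤g ∘ suc))

∑-frac : ∀ {n} (f : Fin n → ℕ) d → ∑ℚ[ i < n ] frac (f i) (suc d) ≡ frac (∑[ i < n ] f i) (suc d)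
∑-frac {zero}  f d = sym (frac-0 d)
∑-frac {suc n} f d = trans (cong (frac (f zero) (suc d) +ℚ_) (∑-frac (f ∘ suc) d)) (frac-+ (f zero) _ d)

⟦⟧-frac : ∀ b → (if b then 1ℚ else 0ℚ) ≡ frac ⟦ b ⟧ 1
⟦⟧-frac false = refl
⟦⟧-frac true  = refl

frac-*-≤ : ∀ a x n → 1 ≤ n → x ≤ n → frac x 1 *ℚ frac a n ≤ℚ frac a 1
frac-*-≤ a x (suc n) _ x≤n = subst (_≤ℚ frac a 1) (sym (frac-* x a n)) (frac-≤ (x * a) a n 0 (begin
  x * a * 1  ≡⟨ ℕ.*-identityʳ (x * a) ⟩
  x * a      ≡⟨ ℕ.*-comm x a ⟩
  a * x      ≤⟨ ℕ.*-monoʳ-≤ a x≤n ⟩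
  a * suc n  ∎))
  where open ℕ.≤-Reasoning

frac-*-≥ : ∀ a x y n r → 1 ≤ n → n ≤ suc r → y ≤ x → frac (y * a) (suc r) ≤ℚ frac x 1 *ℚ frac a n
frac-*-≥ a x y (suc n) r _ n≤r y≤x = subst (frac (y * a) (suc r) ≤ℚ_) (sym (frac-* x a n))
  (frac-≤ (y * a) (x * a) r n (ℕ.*-mono-≤ (ℕ.*-monoˡ-≤ a y≤x) n≤r))

frac-halve : ∀ a b r → a ≤ 2 * b → frac a (2 * suc r) ≤ℚ frac b (suc r)
frac-halve a b r a≤2b = frac-≤ a b (r + suc (r + 0)) r (begin  -- suc (r + suc (r + 0)) is 2 * suc r
  a * suc r        ≤⟨ ℕ.*-monoˡ-≤ (suc r) a≤2b ⟩
  2 * b * suc r    ≡⟨ solve 2 (λ b s → con 2 :* b :* s := b :* (con 2 :* s)) refl b (suc r) ⟩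
  b * (2 * suc r)  ∎)
  where
  open ℕ.≤-Reasoning
  open Data.Nat.Solver.+-*-Solver

if-else-0ℚ : ∀ b x → (if b then x else 0ℚ) ≡ frac ⟦ b ⟧ 1 *ℚ x
if-else-0ℚ true  x = sym (ℚₚ.*-identityˡ x)
if-else-0ℚ false x = sym (ℚₚ.*-zeroˡ x)

sumOver≡∑ℚ : ∀ {n} (X : Subset n) (f : Fin n → ℚ) → sumOver X f ≡ ∑ℚ[ v < n ] (if does (v ∈? X) then f v else 0ℚ)
sumOver≡∑ℚ {n} X f = foldr-tabulate id
  where
  g : Fin n → ℚ
  g v = if does (v ∈? X) then f v else 0ℚ
  foldr-tabulate : ∀ {m} (h : Fin m → Fin n) →
    Data.List.foldr (λ v acc → g v +ℚ acc) 0ℚ (Data.List.tabulate h) ≡ ∑ℚ[ i < m ] g (h i)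
  foldr-tabulate {zero}  h = refl
  foldr-tabulate {suc m} h = cong (g (h zero) +ℚ_) (foldr-tabulate (h ∘ suc))

-- Subsets and walks

∣p∣≡∑𝟙 : ∀ {n} (p : Subset n) → ∣ p ∣ ≡ ∑[ v < n ] 𝟙 (v ∈? p)
∣p∣≡∑𝟙 []          = refl
∣p∣≡∑𝟙 (true ∷ p)  = cong suc (∣p∣≡∑𝟙 p)
∣p∣≡∑𝟙 (false ∷ p) = ∣p∣≡∑𝟙 p

module _ {n : ℕ} where

  ∈-tabulate⁺ : ∀ {P : Pred (Fin n) 0ℓ} (P? : Decidable P) {x} → P x → x ∈ tabulate (λ v → ⌊ P? v ⌋)
  ∈-tabulate⁺ {P} P? {x} Px = Vec.lookup⇒[]= x _ (trans (Vec.lookup∘tabulate _ x) (is-yes (P? x)))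
    where
    is-yes : (x? : Dec (P x)) → ⌊ x? ⌋ ≡ true
    is-yes (yes _)  = refl
    is-yes (no ¬Px) = contradiction Px ¬Px

  ∈-tabulate⁻ : ∀ {P : Pred (Fin n) 0ℓ} (P? : Decidable P) {x} → x ∈ tabulate (λ v → ⌊ P? v ⌋) → P x
  ∈-tabulate⁻ P? {x} x∈ = from-yes (P? x) (trans (sym (Vec.lookup∘tabulate _ x)) (Vec.[]=⇒lookup x∈))
    where
    from-yes : ∀ {A : Set} (a? : Dec A) → ⌊ a? ⌋ ≡ true → A
    from-yes (yes a) _ = a

  x∈p⇒0<∣p∣ : ∀ {p : Subset n} {x} → x ∈ p → 0 < ∣ p ∣
  x∈p⇒0<∣p∣ {p} {x} x∈p = subst (_≤ ∣ p ∣) (∣⁅x⁆∣≡1 x) (p⊆q⇒∣p∣≤∣q∣ ⁅x⁆⊆p)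
    where
    ⁅x⁆⊆p : ⁅ x ⁆ ⊆ p
    ⁅x⁆⊆p y∈⁅x⁆ = subst (_∈ p) (sym (x∈⁅y⁆⇒x≡y x y∈⁅x⁆)) x∈p

  𝟙-nonempty≤∣p∣ : (p : Subset n) → 𝟙 (nonempty? p) ≤ ∣ p ∣
  𝟙-nonempty≤∣p∣ p with nonempty? p
  ... | yes (x , x∈p) = x∈p⇒0<∣p∣ x∈p
  ... | no _          = z≤n

module _ {G : Multigraph} where

  WalkIn-⊆ : ∀ {B B′ a b} → B ⊆ B′ → WalkIn G B a b → WalkIn G B′ a b
  WalkIn-⊆ B⊆B′ (here a∈B)        = here (B⊆B′ a∈B)
  WalkIn-⊆ B⊆B′ (step a∈B adj w)  = step (B⊆B′ a∈B) adj (WalkIn-⊆ B⊆B′ w)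

  WalkIn-bridge : ∀ {B x a b y} → WalkIn G B x a → Adj G a b → WalkIn G B b y → WalkIn G B x y
  WalkIn-bridge (here a∈B)        ab w = step a∈B ab w
  WalkIn-bridge (step x∈B adj w′) ab w = step x∈B adj (WalkIn-bridge w′ ab w)

-- Degrees in a loopless multigraph

touches-or-avoids : ∀ x y → 1 ≤ (⟦ x ⟧ + ⟦ y ⟧) + ⟦ not x ∧ not y ⟧
touches-or-avoids true  y     = s≤s z≤n
touches-or-avoids false true  = s≤s z≤n
touches-or-avoids false false = s≤s z≤n

avoiding-ends : ∀ x y → ⟦ not x ⟧ + ⟦ not y ⟧ ≤ 2 * ⟦ not x ∧ not y ⟧ + (⟦ x ⟧ + ⟦ y ⟧)
avoiding-ends true  true  = z≤n
avoiding-ends true  false = s≤s z≤n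
avoiding-ends false true  = s≤s z≤n
avoiding-ends false false = s≤s (s≤s z≤n)

endpoint-𝟙 : ∀ {n} {a b : Fin n} → a ≢ b → ∀ i → 𝟙 (a ≟ i ⊎-dec b ≟ i) ≡ δ a i + δ b i
endpoint-𝟙 {a = a} {b} a≢b i with a ≟ i | b ≟ i
... | yes refl | yes refl = contradiction refl a≢b
... | yes _    | no _     = refl
... | no _     | yes _    = refl
... | no _     | no _     = refl

module _ (H : Multigraph) where

  handshake : (Q : Fin (V H) → ℕ) →
    ∑[ i < V H ] (Q i * deg H i) ≡ ∑ᴸ (E H) (λ e → Q (proj₁ e) + Q (proj₂ e))
  handshake Q = begin
    ∑[ i < V H ] (Q i * deg H i)
      ≡⟨ sum-cong-≗ {V H} (λ i → cong (Q i *_) (length-filter _ (E H))) ⟩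
    ∑[ i < V H ] (Q i * ∑ᴸ (E H) (λ e → 𝟙 (proj₁ e ≟ i ⊎-dec proj₂ e ≟ i)))
      ≡⟨ sum-cong-≗ {V H} (λ i → *-distribˡ-sum {length (E H)} (Q i) _) ⟩
    ∑[ i < V H ] ∑ᴸ (E H) (λ e → Q i * 𝟙 (proj₁ e ≟ i ⊎-dec proj₂ e ≟ i))
      ≡⟨ ∑-comm {V H} {length (E H)} _ ⟩
    ∑ᴸ (E H) (λ e → ∑[ i < V H ] (Q i * 𝟙 (proj₁ e ≟ i ⊎-dec proj₂ e ≟ i)))
      ≡⟨ sum-cong-≗ {length (E H)} (λ j → ends (All.lookup (loopless H) (∈-lookup j))) ⟩
    ∑ᴸ (E H) (λ e → Q (proj₁ e) + Q (proj₂ e))  ∎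
    where
    open ≡-Reasoning
    ends : ∀ {a b} → a ≢ b → ∑[ i < V H ] (Q i * 𝟙 (a ≟ i ⊎-dec b ≟ i)) ≡ Q a + Q b
    ends {a} {b} a≢b = begin
      ∑[ i < V H ] (Q i * 𝟙 (a ≟ i ⊎-dec b ≟ i))        ≡⟨ sum-cong-≗ {V H} split ⟩
      ∑[ i < V H ] (δ a i * Q i + δ b i * Q i)          ≡⟨ ∑-distrib-+ {V H} _ _ ⟩
      ∑[ i < V H ] (δ a i * Q i) + ∑[ i < V H ] (δ b i * Q i)  ≡⟨ cong₂ _+_ (∑-δ a Q) (∑-δ b Q) ⟩
      Q a + Q b                                         ∎
      where
      split : ∀ i → Q i * 𝟙 (a ≟ i ⊎-dec b ≟ i) ≡ δ a i * Q i + δ b i * Q i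
      split i = trans (cong (Q i *_) (endpoint-𝟙 a≢b i))
                      (trans (ℕ.*-distribˡ-+ (Q i) (δ a i) (δ b i)) (cong₂ _+_ (ℕ.*-comm (Q i) _) (ℕ.*-comm (Q i) _)))

  ∑deg≡2∥E∥ : ∑[ i < V H ] deg H i ≡ 2 * ∥E∥ H
  ∑deg≡2∥E∥ = begin
    ∑[ i < V H ] deg H i          ≡⟨ sum-cong-≗ {V H} (λ i → sym (ℕ.*-identityˡ (deg H i))) ⟩
    ∑[ i < V H ] (1 * deg H i)    ≡⟨ handshake (λ _ → 1) ⟩
    ∑ᴸ (E H) (λ _ → 2 * 1)        ≡⟨ *-distribˡ-sum {length (E H)} 2 _ ⟨
    2 * ∑ᴸ (E H) (λ _ → 1)        ≡⟨ cong (2 *_) (length≡∑ᴸ1 (E H)) ⟨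
    2 * ∥E∥ H                     ∎
    where open ≡-Reasoning

  module _ {A : Pred (Fin (V H)) 0ℓ} (A? : Decidable A) where

    Avoids : Pred (Fin (V H) × Fin (V H)) 0ℓ
    Avoids e = ¬ A (proj₁ e) × ¬ A (proj₂ e)

    avoids? : Decidable Avoids
    avoids? e = ¬? (A? (proj₁ e)) ×-dec ¬? (A? (proj₂ e))

    ∥E∥≤2∑deg : ∀ c → minDeg≥ H (8 * c) → ∑ᴸ (E H) (𝟙 ∘ avoids?) ≤ c * ∑[ i < V H ] 𝟙 (¬? (A? i)) →
      ∥E∥ H ≤ 2 * ∑[ i < V H ] (𝟙 (A? i) * deg H i)
    ∥E∥≤2∑deg c δ≥8c sparse = begin
      ∥E∥ H        ≤⟨ covered ⟩
      degA + cB    ≤⟨ ℕ.+-monoʳ-≤ degA cB≤degA ⟩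
      degA + degA  ≡⟨ cong (degA +_) (sym (ℕ.+-identityʳ degA)) ⟩
      2 * degA     ∎
      where
      open ℕ.≤-Reasoning
      m = length (E H)
      cB = ∑ᴸ (E H) (𝟙 ∘ avoids?)
      nB = ∑[ i < V H ] 𝟙 (¬? (A? i))
      degA = ∑[ i < V H ] (𝟙 (A? i) * deg H i)
      degB = ∑[ i < V H ] (𝟙 (¬? (A? i)) * deg H i)

      ends : (Fin (V H) → ℕ) → Fin (V H) × Fin (V H) → ℕ
      ends f e = f (proj₁ e) + f (proj₂ e)
      inA₁ inA₂ : Fin m → Bool
      inA₁ j = does (A? (proj₁ (lookup (E H) j)))
      inA₂ j = does (A? (proj₂ (lookup (E H) j)))

      covered : ∥E∥ H ≤ degA + cB
      covered = begin
        ∥E∥ H                                              ≡⟨ length≡∑ᴸ1 (E H) ⟩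
        ∑ᴸ (E H) (λ _ → 1)                                 ≤⟨ ∑-mono-≤ {m} (λ j → touches-or-avoids (inA₁ j) (inA₂ j)) ⟩
        ∑ᴸ (E H) (λ e → ends (𝟙 ∘ A?) e + 𝟙 (avoids? e))   ≡⟨ ∑-distrib-+ {m} _ _ ⟩
        ∑ᴸ (E H) (ends (𝟙 ∘ A?)) + cB                      ≡⟨ cong (_+ cB) (handshake (𝟙 ∘ A?)) ⟨
        degA + cB                                          ∎

      degB-bounds : 8 * (c * nB) ≤ 2 * cB + degA
      degB-bounds = begin
        8 * (c * nB)                                        ≡⟨ trans (sym (ℕ.*-assoc 8 c nB)) (ℕ.*-comm (8 * c) nB) ⟩
        nB * (8 * c)                                        ≡⟨ *-distribʳ-sum {V H} (8 * c) _ ⟩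
        ∑[ i < V H ] (𝟙 (¬? (A? i)) * (8 * c))              ≤⟨ ∑-mono-≤ {V H} (λ i → ℕ.*-monoʳ-≤ (𝟙 (¬? (A? i))) (δ≥8c i)) ⟩
        degB                                                ≡⟨ handshake (𝟙 ∘ ¬? ∘ A?) ⟩
        ∑ᴸ (E H) (ends (𝟙 ∘ ¬? ∘ A?))                       ≤⟨ ∑-mono-≤ {m} (λ j → avoiding-ends (inA₁ j) (inA₂ j)) ⟩
        ∑ᴸ (E H) (λ e → 2 * 𝟙 (avoids? e) + ends (𝟙 ∘ A?) e)  ≡⟨ ∑-distrib-+ {m} _ _ ⟩
        ∑ᴸ (E H) (λ e → 2 * 𝟙 (avoids? e)) + ∑ᴸ (E H) (ends (𝟙 ∘ A?))
                                                            ≡⟨ cong₂ _+_ (*-distribˡ-sum {m} 2 _) (handshake (𝟙 ∘ A?)) ⟨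
        2 * cB + degA                                       ∎

      cB≤degA : cB ≤ degA
      cB≤degA = ℕ.≤-trans (ℕ.m≤m*n cB 6) (ℕ.+-cancelˡ-≤ (2 * cB) (cB * 6) degA (begin
        2 * cB + cB * 6  ≡⟨ solve 1 (λ x → con 2 :* x :+ x :* con 6 := con 8 :* x) refl cB ⟩
        8 * cB           ≤⟨ ℕ.*-monoʳ-≤ 8 sparse ⟩
        8 * (c * nB)     ≤⟨ degB-bounds ⟩
        2 * cB + degA    ∎))
        where open Data.Nat.Solver.+-*-Solver

-- θ_c models and the crossing-edge bound

module _ (G : Multigraph) where

  EdgeBetween : Subset (V G) → Subset (V G) → Pred (Fin (V G) × Fin (V G)) 0ℓ
  EdgeBetween B₁ B₂ e = (proj₁ e ∈ B₁ × proj₂ e ∈ B₂) ⊎ (proj₁ e ∈ B₂ × proj₂ e ∈ B₁)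

  edgeBetween? : (B₁ B₂ : Subset (V G)) → Decidable (EdgeBetween B₁ B₂)
  edgeBetween? B₁ B₂ e = (proj₁ e ∈? B₁ ×-dec proj₂ e ∈? B₂) ⊎-dec (proj₁ e ∈? B₂ ×-dec proj₂ e ∈? B₁)

  θ-model : ∀ c {T} (B₁ B₂ : Subset (V G)) → B₁ ⊆ T → B₂ ⊆ T → Nonempty B₁ → Nonempty B₂ →
    (∀ {x} → x ∈ B₁ → x ∉ B₂) → ConnectedSet G B₁ → ConnectedSet G B₂ →
    c ≤ ∑ᴸ (E G) (𝟙 ∘ edgeBetween? B₁ B₂) → MinorModelIn G T (θ c)
  θ-model c {T} B₁ B₂ B₁⊆T B₂⊆T ∃B₁ ∃B₂ B₁∩B₂=∅ B₁-conn B₂-conn c≤ = record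
    { branch    = branch
    ; inS       = λ { zero _ → B₁⊆T ; (suc zero) _ → B₂⊆T }
    ; nonempty  = λ { zero → ∃B₁ ; (suc zero) → ∃B₂ }
    ; disjoint  = disjoint
    ; connected = λ { zero → B₁-conn ; (suc zero) → B₂-conn }
    ; edgeMap   = proj₁ chosen
    ; edgeInj   = proj₁ (proj₂ chosen)
    ; edgeOk    = edgeOk
    }
    where
    branch : Fin 2 → Subset (V G)
    branch zero       = B₁
    branch (suc zero) = B₂

    disjoint : ∀ u u′ x → x ∈ branch u → x ∈ branch u′ → u ≡ u′
    disjoint zero       zero       _ _  _  = refl
    disjoint (suc zero) (suc zero) _ _  _  = refl
    disjoint zero       (suc zero) _ x₁ x₂ = contradiction x₂ (B₁∩B₂=∅ x₁)
    disjoint (suc zero) zero       _ x₂ x₁ = contradiction x₂ (B₁∩B₂=∅ x₁)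

    chosen = ∑ᴸ-choice (edgeBetween? B₁ B₂) (E G) (subst (_≤ _) (sym (length-replicate c)) c≤)

    θ-edge : ∀ j → lookup (E (θ c)) j ≡ (zero , suc zero)
    θ-edge j = All.lookup (replicate⁺ {P = _≡ (zero , suc zero)} c refl) (∈-lookup j)

    edgeOk : ∀ j → let u = proj₁ (lookup (E (θ c)) j) ; u′ = proj₂ (lookup (E (θ c)) j)
                       a = proj₁ (lookup (E G) (proj₁ chosen j)) ; b = proj₂ (lookup (E G) (proj₁ chosen j))
                   in (a ∈ branch u × b ∈ branch u′) ⊎ (a ∈ branch u′ × b ∈ branch u)
    edgeOk j rewrite θ-edge j = proj₂ (proj₂ chosen) j

module CrossingEdges (G : Multigraph) {c : ℕ} {T : Subset (V G)} (θ-free : ¬ MinorModelIn G T (θ c))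
  {S : Pred (Fin (V G)) 0ℓ} (S? : Decidable S) (S⊆T : ∀ {v} → S v → v ∈ T) (m : ℕ) where

  Labelling : Set
  Labelling = Fin (V G) → Fin m

  class : Labelling → Fin m → Subset (V G)
  class q j = tabulate (λ x → ⌊ S? x ×-dec q x ≟ j ⌋)

  ∈-class⁺ : ∀ {q j x} → S x → q x ≡ j → x ∈ class q j
  ∈-class⁺ {q} {j} Sx qx≡j = ∈-tabulate⁺ (λ x → S? x ×-dec q x ≟ j) (Sx , qx≡j)

  ∈-class⁻ : ∀ {q j x} → x ∈ class q j → S x × q x ≡ j
  ∈-class⁻ {q} {j} = ∈-tabulate⁻ (λ x → S? x ×-dec q x ≟ j)

  ClassesConnected : Labelling → Set
  ClassesConnected q = ∀ j → ConnectedSet G (class q j)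

  #classes : Labelling → ℕ
  #classes q = ∑[ j < m ] 𝟙 (nonempty? (class q j))

  Crossing : Labelling → Pred (Fin (V G) × Fin (V G)) 0ℓ
  Crossing q e = q (proj₁ e) ≢ q (proj₂ e) × S (proj₁ e) × S (proj₂ e)

  crossing? : (q : Labelling) → Decidable (Crossing q)
  crossing? q e = ¬? (q (proj₁ e) ≟ q (proj₂ e)) ×-dec (S? (proj₁ e) ×-dec S? (proj₂ e))

  #crossing : Labelling → ℕ
  #crossing q = ∑ᴸ (E G) (𝟙 ∘ crossing? q)

  module Merge (q : Labelling) (q-conn : ClassesConnected q) {a b} (ab∈E : (a , b) ∈ˡ E G)
               (Sa : S a) (Sb : S b) (qa≢qb : q a ≢ q b) where

    collapse : Fin m → Fin m
    collapse j = if does (j ≟ q b) then q a else j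

    merged : Labelling
    merged = collapse ∘ q

    collapse-spec : ∀ j → (j ≡ q b × collapse j ≡ q a) ⊎ (j ≢ q b × collapse j ≡ j)
    collapse-spec j with j ≟ q b
    ... | yes j≡qb = inj₁ (j≡qb , refl)
    ... | no j≢qb  = inj₂ (j≢qb , refl)

    collapse≢qb : ∀ j → collapse j ≢ q b
    collapse≢qb j with collapse-spec j
    ... | inj₁ (_ , cj≡qa)    = λ cj≡qb → qa≢qb (trans (sym cj≡qa) cj≡qb)
    ... | inj₂ (j≢qb , cj≡j) = λ cj≡qb → j≢qb (trans (sym cj≡j) cj≡qb)

    collapse-identifies : ∀ {x y} → x ≢ y → collapse x ≡ collapse y →
      (x ≡ q a × y ≡ q b) ⊎ (x ≡ q b × y ≡ q a)
    collapse-identifies {x} {y} x≢y cx≡cy with collapse-spec x | collapse-spec y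
    ... | inj₁ (x≡qb , _)   | inj₁ (y≡qb , _)   = contradiction (trans x≡qb (sym y≡qb)) x≢y
    ... | inj₁ (x≡qb , cx)  | inj₂ (_ , cy)     = inj₂ (x≡qb , trans (sym cy) (trans (sym cx≡cy) cx))
    ... | inj₂ (_ , cx)     | inj₁ (y≡qb , cy)  = inj₁ (trans (sym cx) (trans cx≡cy cy) , y≡qb)
    ... | inj₂ (_ , cx)     | inj₂ (_ , cy)     = contradiction (trans (sym cx) (trans cx≡cy cy)) x≢y

    class-⊆ : ∀ {j j′} → collapse j ≡ j′ → class q j ⊆ class merged j′
    class-⊆ refl x∈ = let Sx , qx≡j = ∈-class⁻ x∈ in ∈-class⁺ Sx (cong collapse qx≡j)

    #between : ℕ
    #between = ∑ᴸ (E G) (𝟙 ∘ edgeBetween? G (class q (q a)) (class q (q b)))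

    model : c ≤ #between → MinorModelIn G T (θ c)
    model = θ-model G c (class q (q a)) (class q (q b)) class⊆T class⊆T
      (a , ∈-class⁺ Sa refl) (b , ∈-class⁺ Sb refl) disjoint (q-conn (q a)) (q-conn (q b))
      where
      class⊆T : ∀ {j} → class q j ⊆ T
      class⊆T x∈ = S⊆T (proj₁ (∈-class⁻ x∈))
      disjoint : ∀ {x} → x ∈ class q (q a) → x ∉ class q (q b)
      disjoint x∈a x∈b = qa≢qb (trans (sym (proj₂ (∈-class⁻ x∈a))) (proj₂ (∈-class⁻ x∈b)))

    crossing-split : ∀ e → Crossing q e → Crossing merged e ⊎ EdgeBetween G (class q (q a)) (class q (q b)) e
    crossing-split (x , y) (qx≢qy , Sx , Sy) with collapse (q x) ≟ collapse (q y)
    ... | no cx≢cy  = inj₁ (cx≢cy , Sx , Sy)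
    ... | yes cx≡cy with collapse-identifies qx≢qy cx≡cy
    ...   | inj₁ (qx≡qa , qy≡qb) = inj₂ (inj₁ (∈-class⁺ Sx qx≡qa , ∈-class⁺ Sy qy≡qb))
    ...   | inj₂ (qx≡qb , qy≡qa) = inj₂ (inj₂ (∈-class⁺ Sx qx≡qb , ∈-class⁺ Sy qy≡qa))

    #crossing-merged : #crossing q ≤ #crossing merged + #between
    #crossing-merged = ℕ.≤-trans
      (∑-mono-≤ {length (E G)} (λ j → 𝟙-≤-+ (crossing-split _) (crossing? q _) (crossing? merged _) (edgeBetween? G _ _ _)))
      (ℕ.≤-reflexive (∑-distrib-+ {length (E G)} _ _))

    #classes-merged : #classes merged < #classes q
    #classes-merged = ∑-mono-< {m} (λ j → 𝟙-mono (shrinks j) (nonempty? _) (nonempty? _)) (q b)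
      (𝟙-< emptied (b , ∈-class⁺ {q} Sb refl) (nonempty? _) (nonempty? _))
      where
      shrinks : ∀ j → Nonempty (class merged j) → Nonempty (class q j)
      shrinks j (x , x∈) with ∈-class⁻ x∈ | collapse-spec (q x)
      ... | Sx , cx≡j | inj₁ (_ , cx≡qa) = a , ∈-class⁺ Sa (trans (sym cx≡qa) cx≡j)
      ... | Sx , cx≡j | inj₂ (_ , cx≡qx) = x , ∈-class⁺ Sx (trans (sym cx≡qx) cx≡j)
      emptied : ¬ Nonempty (class merged (q b))
      emptied (x , x∈) = collapse≢qb (q x) (proj₂ (∈-class⁻ x∈))

    walk-across : ∀ {j x y u v} → Adj G u v → S u → S v → x ∈ class q (q u) → y ∈ class q (q v) →
      collapse (q u) ≡ j → collapse (q v) ≡ j → WalkIn G (class merged j) x y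
    walk-across {x = x} {y} {u} {v} uv Su Sv x∈u y∈v cu≡j cv≡j = WalkIn-bridge
      (WalkIn-⊆ (class-⊆ cu≡j) (q-conn (q u) x u x∈u (∈-class⁺ Su refl))) uv
      (WalkIn-⊆ (class-⊆ cv≡j) (q-conn (q v) v y (∈-class⁺ Sv refl) y∈v))

    merged-connected : ClassesConnected merged
    merged-connected j x y x∈ y∈ with ∈-class⁻ x∈ | ∈-class⁻ y∈
    ... | Sx , cx≡j | Sy , cy≡j with q x ≟ q y
    ...   | yes qx≡qy = WalkIn-⊆ (class-⊆ cx≡j) (q-conn (q x) x y (∈-class⁺ Sx refl) (∈-class⁺ Sy (sym qx≡qy)))
    ...   | no qx≢qy with collapse-identifies qx≢qy (trans cx≡j (sym cy≡j))
    ...     | inj₁ (qx≡qa , qy≡qb) = walk-across (inj₁ ab∈E) Sa Sb (∈-class⁺ Sx qx≡qa) (∈-class⁺ Sy qy≡qb)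
                                       (trans (cong collapse (sym qx≡qa)) cx≡j) (trans (cong collapse (sym qy≡qb)) cy≡j)
    ...     | inj₂ (qx≡qb , qy≡qa) = walk-across (inj₂ ab∈E) Sb Sa (∈-class⁺ Sx qx≡qb) (∈-class⁺ Sy qy≡qa)
                                       (trans (cong collapse (sym qx≡qb)) cx≡j) (trans (cong collapse (sym qy≡qa)) cy≡j)

    #crossing-step : c ≰ #between → #crossing merged ≤ c * #classes merged → #crossing q ≤ c * #classes q
    #crossing-step c≰ IH = begin
      #crossing q                       ≤⟨ #crossing-merged ⟩
      #crossing merged + #between       ≤⟨ ℕ.+-mono-≤ IH (ℕ.<⇒≤ (ℕ.≰⇒> c≰)) ⟩
      c * #classes merged + c           ≡⟨ trans (ℕ.+-comm _ c) (sym (ℕ.*-suc c _)) ⟩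
      c * suc (#classes merged)         ≤⟨ ℕ.*-monoʳ-≤ c #classes-merged ⟩
      c * #classes q                    ∎
      where open ℕ.≤-Reasoning

  #crossing≤ : ∀ n (q : Labelling) → #classes q ≤ n → ClassesConnected q → #crossing q ≤ c * #classes q
  #crossing≤ n q q≤n q-conn with 1 ℕ.≤? #crossing q
  ... | no 1≰ = subst (_≤ c * #classes q) (sym (ℕ.n<1⇒n≡0 (ℕ.≰⇒> 1≰))) z≤n
  ... | yes 1≤ with ∑ᴸ-choice (crossing? q) (E G) 1≤
  ...   | f , _ , crossing with crossing zero
  ...     | qa≢qb , Sa , Sb = merge n q≤n
    where
    open Merge q q-conn (∈-lookup (f zero)) Sa Sb qa≢qb
    merge : ∀ n → #classes q ≤ n → #crossing q ≤ c * #classes q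
    merge n q≤n with c ℕ.≤? #between
    merge n       q≤n | yes c≤ = contradiction (model c≤) θ-free
    merge zero    q≤0 | no c≰  = contradiction (ℕ.<-≤-trans #classes-merged q≤0) λ ()
    merge (suc n) q≤n | no c≰  =
      #crossing-step c≰ (#crossing≤ n merged (ℕ.≤-pred (ℕ.<-≤-trans #classes-merged q≤n)) merged-connected)

-- Cluster partitions

module Clusters (G : Multigraph) (𝒞 : ClusterPartition G) where

  H : Multigraph
  H = G /ᶜ 𝒞

  ∈-part⁺ : ∀ {i x} → cl 𝒞 x ≡ i → x ∈ part 𝒞 i
  ∈-part⁺ {i} = ∈-tabulate⁺ (λ v → cl 𝒞 v ≟ i)

  ∈-part⁻ : ∀ {i x} → x ∈ part 𝒞 i → cl 𝒞 x ≡ i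
  ∈-part⁻ {i} = ∈-tabulate⁻ (λ v → cl 𝒞 v ≟ i)

  ∑ᴸ-contracted : (h : Fin (k 𝒞) × Fin (k 𝒞) → ℕ) → ∑ᴸ (E H) h ≡
    ∑ᴸ (E G) (λ e → 𝟙 (¬? (cl 𝒞 (proj₁ e) ≟ cl 𝒞 (proj₂ e))) * h (cl 𝒞 (proj₁ e) , cl 𝒞 (proj₂ e)))
  ∑ᴸ-contracted h = trans (∑ᴸ-map contract (filter inter? (E G)) h) (∑ᴸ-filter inter? (E G) (h ∘ contract))
    where
    inter? : (e : Fin (V G) × Fin (V G)) → Dec (cl 𝒞 (proj₁ e) ≢ cl 𝒞 (proj₂ e))
    inter? e = ¬? (cl 𝒞 (proj₁ e) ≟ cl 𝒞 (proj₂ e))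
    contract : Fin (V G) × Fin (V G) → Fin (k 𝒞) × Fin (k 𝒞)
    contract e = cl 𝒞 (proj₁ e) , cl 𝒞 (proj₂ e)

  ∣ext∣≡deg : ∀ i → length (ext G (part 𝒞 i)) ≡ deg H i
  ∣ext∣≡deg i = begin
    length (ext G (part 𝒞 i))
      ≡⟨ length-filter _ (E G) ⟩
    ∑ᴸ (E G) (λ e → ⟦ does ((does (proj₁ e ∈? part 𝒞 i) xor does (proj₂ e ∈? part 𝒞 i)) Bool.≟ true) ⟧)
      ≡⟨ sum-cong-≗ {length (E G)} (λ j → exactly-one (lookup (E G) j)) ⟩
    ∑ᴸ (E G) (λ e → 𝟙 (¬? (c₁ e ≟ c₂ e)) * 𝟙 (c₁ e ≟ i ⊎-dec c₂ e ≟ i))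
      ≡⟨ ∑ᴸ-contracted (λ e → 𝟙 (proj₁ e ≟ i ⊎-dec proj₂ e ≟ i)) ⟨
    ∑ᴸ (E H) (λ e → 𝟙 (proj₁ e ≟ i ⊎-dec proj₂ e ≟ i))
      ≡⟨ length-filter _ (E H) ⟨
    deg H i ∎
    where
    open ≡-Reasoning
    c₁ c₂ : Fin (V G) × Fin (V G) → Fin (k 𝒞)
    c₁ e = cl 𝒞 (proj₁ e)
    c₂ e = cl 𝒞 (proj₂ e)
    ∈?≡≟ : ∀ x → does (x ∈? part 𝒞 i) ≡ does (cl 𝒞 x ≟ i)
    ∈?≡≟ x = does-cong ∈-part⁻ ∈-part⁺ (x ∈? part 𝒞 i) (cl 𝒞 x ≟ i)
    exactly-one : ∀ e → ⟦ does ((does (proj₁ e ∈? part 𝒞 i) xor does (proj₂ e ∈? part 𝒞 i)) Bool.≟ true) ⟧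
                      ≡ 𝟙 (¬? (c₁ e ≟ c₂ e)) * 𝟙 (c₁ e ≟ i ⊎-dec c₂ e ≟ i)
    exactly-one e = trans (cong ⟦_⟧ (begin
      does ((does (proj₁ e ∈? part 𝒞 i) xor does (proj₂ e ∈? part 𝒞 i)) Bool.≟ true)
        ≡⟨ does-≟-true _ ⟩
      does (proj₁ e ∈? part 𝒞 i) xor does (proj₂ e ∈? part 𝒞 i)
        ≡⟨ cong₂ _xor_ (∈?≡≟ (proj₁ e)) (∈?≡≟ (proj₂ e)) ⟩
      does (c₁ e ≟ i) xor does (c₂ e ≟ i)
        ≡⟨ xor-≟ (c₁ e) (c₂ e) i ⟩
      not (does (c₁ e ≟ c₂ e)) ∧ (does (c₁ e ≟ i) ∨ does (c₂ e ≟ i)) ∎))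
      (⟦∧⟧ (not (does (c₁ e ≟ c₂ e))) (does (c₁ e ≟ i) ∨ does (c₂ e ≟ i)))

  0<∣part∣ : ∀ i → 0 < ∣ part 𝒞 i ∣
  0<∣part∣ i = x∈p⇒0<∣p∣ (∈-part⁺ (proj₂ (nonempty 𝒞 i)))

  module _ (X : Subset (V G)) where

    Hit : Pred (Fin (k 𝒞)) 0ℓ
    Hit i = Nonempty (X ∩ part 𝒞 i)

    hit? : Decidable Hit
    hit? i = nonempty? (X ∩ part 𝒞 i)

    unhit⊆∁X : ∀ {v} → ¬ Hit (cl 𝒞 v) → v ∈ ∁ X
    unhit⊆∁X ¬hit = x∉p⇒x∈∁p (λ v∈X → ¬hit (_ , x∈p∩q⁺ (v∈X , ∈-part⁺ refl)))

    ∥E∥≤2∑deg-hit : ∀ {c} → BondCover c G X → minDeg≥ H (8 * c) →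
      ∥E∥ H ≤ 2 * ∑[ i < k 𝒞 ] (𝟙 (hit? i) * deg H i)
    ∥E∥≤2∑deg-hit {c} cover δ≥8c = ∥E∥≤2∑deg H hit? c δ≥8c (begin
      ∑ᴸ (E H) (𝟙 ∘ avoids? H hit?)      ≡⟨ avoiding≡crossing ⟩
      #crossing (cl 𝒞)                   ≤⟨ #crossing≤ _ (cl 𝒞) ℕ.≤-refl clusters-connected ⟩
      c * #classes (cl 𝒞)                ≤⟨ ℕ.*-monoʳ-≤ c #classes≤ ⟩
      c * ∑[ i < k 𝒞 ] 𝟙 (¬? (hit? i))   ∎)
      where
      open ℕ.≤-Reasoning
      open CrossingEdges G cover (λ v → ¬? (hit? (cl 𝒞 v))) unhit⊆∁X (k 𝒞)

      avoiding≡crossing : ∑ᴸ (E H) (𝟙 ∘ avoids? H hit?) ≡ #crossing (cl 𝒞)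
      avoiding≡crossing = trans (∑ᴸ-contracted (𝟙 ∘ avoids? H hit?))
        (sum-cong-≗ {length (E G)} (λ j → sym (both (lookup (E G) j))))
        where
        both : ∀ e → 𝟙 (crossing? (cl 𝒞) e) ≡ _
        both e = ⟦∧⟧ (not (does (cl 𝒞 (proj₁ e) ≟ cl 𝒞 (proj₂ e))))
                     (not (does (hit? (cl 𝒞 (proj₁ e)))) ∧ not (does (hit? (cl 𝒞 (proj₂ e)))))

      clusters-connected : ClassesConnected (cl 𝒞)
      clusters-connected j x y x∈ y∈ = WalkIn-⊆ part⊆class (connected 𝒞 j x y (∈-part⁺ cx≡j) (∈-part⁺ (proj₂ (∈-class⁻ y∈))))
        where
        Sx = proj₁ (∈-class⁻ x∈)
        cx≡j = proj₂ (∈-class⁻ x∈)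
        part⊆class : part 𝒞 j ⊆ class (cl 𝒞) j
        part⊆class z∈ = ∈-class⁺ (subst (¬_ ∘ Hit) (trans cx≡j (sym (∈-part⁻ z∈))) Sx) (∈-part⁻ z∈)

      #classes≤ : #classes (cl 𝒞) ≤ ∑[ i < k 𝒞 ] 𝟙 (¬? (hit? i))
      #classes≤ = ∑-mono-≤ {k 𝒞} (λ j → 𝟙-mono (unhit j) (nonempty? _) (¬? (hit? j)))
        where
        unhit : ∀ j → Nonempty (class (cl 𝒞) j) → ¬ Hit j
        unhit j (z , z∈) = subst (¬_ ∘ Hit) (proj₂ (∈-class⁻ z∈)) (proj₁ (∈-class⁻ z∈))

    weight-sum : sumOver X (weight G 𝒞) ≡
      ∑ℚ[ i < k 𝒞 ] (frac (∣ X ∩ part 𝒞 i ∣) 1 *ℚ frac (length (ext G (part 𝒞 i))) (∣ part 𝒞 i ∣))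
    weight-sum = begin
      sumOver X (weight G 𝒞)
        ≡⟨ sumOver≡∑ℚ X (weight G 𝒞) ⟩
      ∑ℚ[ v < V G ] (if does (v ∈? X) then w (cl 𝒞 v) else 0ℚ)
        ≡⟨ ∑ℚ.sum-cong-≗ {V G} (λ v → if-else-0ℚ (does (v ∈? X)) (w (cl 𝒞 v))) ⟩
      ∑ℚ[ v < V G ] (frac (𝟙 (v ∈? X)) 1 *ℚ w (cl 𝒞 v))
        ≡⟨ δℚ.∑-fibres (cl 𝒞) (λ v → frac (𝟙 (v ∈? X)) 1) w ⟩
      ∑ℚ[ i < k 𝒞 ] (∑ℚ[ v < V G ] (frac (𝟙 (v ∈? X)) 1 *ℚ δℚ.δ (cl 𝒞 v) i) *ℚ w i)
        ≡⟨ ∑ℚ.sum-cong-≗ {k 𝒞} (λ i → cong (_*ℚ w i) (∣X∩part∣ i)) ⟩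
      ∑ℚ[ i < k 𝒞 ] (frac (∣ X ∩ part 𝒞 i ∣) 1 *ℚ w i) ∎
      where
      open ≡-Reasoning
      w : Fin (k 𝒞) → ℚ
      w i = frac (length (ext G (part 𝒞 i))) (∣ part 𝒞 i ∣)
      ∣X∩part∣ : ∀ i → ∑ℚ[ v < V G ] (frac (𝟙 (v ∈? X)) 1 *ℚ δℚ.δ (cl 𝒞 v) i) ≡ frac (∣ X ∩ part 𝒞 i ∣) 1
      ∣X∩part∣ i = begin
        ∑ℚ[ v < V G ] (frac (𝟙 (v ∈? X)) 1 *ℚ δℚ.δ (cl 𝒞 v) i)
          ≡⟨ ∑ℚ.sum-cong-≗ {V G} (λ v → trans (cong (frac (𝟙 (v ∈? X)) 1 *ℚ_) (⟦⟧-frac (does (cl 𝒞 v ≟ i)))) (frac-* (𝟙 (v ∈? X)) (δ (cl 𝒞 v) i) 0)) ⟩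
        ∑ℚ[ v < V G ] frac (𝟙 (v ∈? X) * δ (cl 𝒞 v) i) 1
          ≡⟨ ∑-frac (λ v → 𝟙 (v ∈? X) * δ (cl 𝒞 v) i) 0 ⟩
        frac (∑[ v < V G ] (𝟙 (v ∈? X) * δ (cl 𝒞 v) i)) 1
          ≡⟨ cong (λ n → frac n 1) (trans (sum-cong-≗ {V G} member) (sym (∣p∣≡∑𝟙 (X ∩ part 𝒞 i)))) ⟩
        frac (∣ X ∩ part 𝒞 i ∣) 1 ∎
        where
        member : ∀ v → 𝟙 (v ∈? X) * δ (cl 𝒞 v) i ≡ 𝟙 (v ∈? X ∩ part 𝒞 i)
        member v = trans (sym (⟦∧⟧ (does (v ∈? X)) (does (cl 𝒞 v ≟ i))))
          (𝟙-cong (λ (v∈X , cv≡i) → x∈p∩q⁺ (v∈X , ∈-part⁺ cv≡i))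
                  (λ v∈ → proj₁ (x∈p∩q⁻ X (part 𝒞 i) v∈) , ∈-part⁻ (proj₂ (x∈p∩q⁻ X (part 𝒞 i) v∈)))
                  (v ∈? X ×-dec cl 𝒞 v ≟ i) (v ∈? X ∩ part 𝒞 i))

    weight-sum≤ : sumOver X (weight G 𝒞) ≤ℚ frac (2 * ∥E∥ H) 1
    weight-sum≤ = begin
      sumOver X (weight G 𝒞)
        ≡⟨ weight-sum ⟩
      ∑ℚ[ i < k 𝒞 ] (frac (∣ X ∩ part 𝒞 i ∣) 1 *ℚ frac (length (ext G (part 𝒞 i))) (∣ part 𝒞 i ∣))
        ≤⟨ ∑ℚ-mono-≤ (λ i → frac-*-≤ _ _ _ (0<∣part∣ i) (∣p∩q∣≤∣q∣ X (part 𝒞 i))) ⟩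
      ∑ℚ[ i < k 𝒞 ] frac (length (ext G (part 𝒞 i))) 1
        ≡⟨ ∑-frac (λ i → length (ext G (part 𝒞 i))) 0 ⟩
      frac (∑[ i < k 𝒞 ] length (ext G (part 𝒞 i))) 1
        ≡⟨ cong (λ n → frac n 1) (trans (sum-cong-≗ {k 𝒞} ∣ext∣≡deg) (∑deg≡2∥E∥ H)) ⟩
      frac (2 * ∥E∥ H) 1 ∎
      where open ℚₚ.≤-Reasoning

    weight-sum≥ : ∀ r → CapacityAtMost 𝒞 (suc r) →
      frac (∑[ i < k 𝒞 ] (𝟙 (hit? i) * deg H i)) (suc r) ≤ℚ sumOver X (weight G 𝒞)
    weight-sum≥ r cap = begin
      frac (∑[ i < k 𝒞 ] (𝟙 (hit? i) * deg H i)) (suc r)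
        ≡⟨ cong (λ n → frac n (suc r)) (sum-cong-≗ {k 𝒞} (λ i → cong (𝟙 (hit? i) *_) (∣ext∣≡deg i))) ⟨
      frac (∑[ i < k 𝒞 ] (𝟙 (hit? i) * length (ext G (part 𝒞 i)))) (suc r)
        ≡⟨ ∑-frac (λ i → 𝟙 (hit? i) * length (ext G (part 𝒞 i))) r ⟨
      ∑ℚ[ i < k 𝒞 ] frac (𝟙 (hit? i) * length (ext G (part 𝒞 i))) (suc r)
        ≤⟨ ∑ℚ-mono-≤ (λ i → frac-*-≥ _ _ _ _ r (0<∣part∣ i) (cap i) (𝟙-nonempty≤∣p∣ (X ∩ part 𝒞 i))) ⟩
      ∑ℚ[ i < k 𝒞 ] (frac (∣ X ∩ part 𝒞 i ∣) 1 *ℚ frac (length (ext G (part 𝒞 i))) (∣ part 𝒞 i ∣))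
        ≡⟨ weight-sum ⟨
      sumOver X (weight G 𝒞) ∎
      where open ℚₚ.≤-Reasoning

lemma4p1 : (c r : ℕ) → 1 ≤ r → (G : Multigraph) → (𝒞 : ClusterPartition G) →
    CapacityAtMost 𝒞 r → minDeg≥ (G /ᶜ 𝒞) (8 * c) →
    (X : Subset (V G)) → BondCover c G X →
    (frac (∥E∥ (G /ᶜ 𝒞)) (2 * r) ≤ℚ sumOver X (weight G 𝒞))
      × (sumOver X (weight G 𝒞) ≤ℚ frac (2 * ∥E∥ (G /ᶜ 𝒞)) 1)
lemma4p1 c (suc r) _ G 𝒞 cap δ≥8c X cover = lower , weight-sum≤ X
  where
  open Clusters G 𝒞
  lower : frac (∥E∥ H) (2 * suc r) ≤ℚ sumOver X (weight G 𝒞)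
  lower = ℚₚ.≤-trans
    (frac-halve (∥E∥ H) (∑[ i < k 𝒞 ] (𝟙 (hit? X i) * deg H i)) r (∥E∥≤2∑deg-hit X cover δ≥8c))
    (weight-sum≥ X r cap)
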